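{- For every maximal consistent set $\Gamma$ (in $\mathbb{SKYR}$), $\langle\Gamma,F^\Gamma,\vec{f}^\Gamma\rangle\in W^c$, where $F^\Gamma=\bigcup_{n\in\mathbb{N}}F^\Gamma_n$ with $F^\Gamma_0=\{(e_\top,\phi)\mid\phi\in\Lambda\}\cup\{(\psi_\phi,\psi)\mid\exists b\in\mathcal{A}:Ky_b^r(\phi,\psi)\land\phi\in\Gamma\}$ and $F^\Gamma_{n+1}=F^\Gamma_n\cup\{((s\cdot r)_{\alpha\land\beta},\psi)\mid(s_\alpha,\phi\to\psi),(r_\beta,\phi)\in F^\Gamma_n\}$, and where $f_b^\phi(\psi)=\psi_\phi$ for all $b\in\mathcal{A}$, $\phi\in\mathcal{L}_{ELKy^r}$ and $\psi$ with $Ky_b^r(\phi,\psi)\in\Gamma$.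
   Context: $\mathcal{L}_{ELKy^r}$: $\phi ::= p\mid\neg\phi\mid(\phi\land\phi)\mid K_a\phi\mid Ky_a^r(\phi,\phi)$ over a countably infinite set of atoms $\mathcal{P}$ and countable set of agents $\mathcal{A}$. $\Lambda\subseteq\mathcal{L}_{ELKy^r}$ is a fixed set (tautology ground). $\mathbb{SKYR}$ is the Hilbert system with axioms (PT) propositional tautologies; (K) $K_a(\phi\to\psi)\to(K_a\phi\to K_a\psi)$; (T) $K_a\phi\to\phi$; (4) $K_a\phi\to K_aK_a\phi$; (5) $\neg K_a\phi\to K_a\neg K_a\phi$; (EKyR) $Ky_a^r(\chi,\phi\to\psi)\to(Ky_a^r(\theta,\phi)\to Ky_a^r(\chi\land\theta,\psi))$; (4YKR) $Ky_a^r(\phi,\psi)\to K_aKy_a^r(\phi,\psi)$; (DKyR) $Ky_a^r(\phi,\psi)\to K_a(\phi\to\psi)$; (IKyR) $Ky_a^r(\psi,\chi)\to(K_a(\phi\to\psi)\to Ky_a^r(\phi,\chi))$; (UKyR) $K_a\neg\phi\to Ky_a^r(\phi,\psi)$; rules (MP), (NK), (NKyR) from $\phi\in\Lambda$ infer $\vdash Ky_a^r(\top,\phi)$; maximal consistent sets as usual. $\hat{E}^c$ is the set of terms $t::=e\mid\phi\mid(t\cdot t)$ with $\phi\in\mathcal{L}_{ELKy^r}$ (formulas as atomic term symbols). $E^c=\{e_\top\}\cup\{t_\phi\mid t\in\hat{E}^c\setminus\{e\},\phi\in\mathcal{L}_{ELKy^r}\}$, with $t_\phi\cdot s_\psi:=(t\cdot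 s)_{\phi\land\psi}$ ($e_\top$ read as $t=e,\phi=\top$). $W^c$ is the set of triples $\langle\Gamma,F,\vec{f}\rangle$ with $\Gamma$ maximal consistent, $F\subseteq E^c\times\mathcal{L}_{ELKy^r}$, $\vec{f}=(f^\phi_a)_{a\in\mathcal{A},\phi}$ with $f^\phi_a:\{\psi\mid Ky_a^r(\phi,\psi)\in\Gamma\}\to E^c$, such that: (1) $(s_\alpha,\phi\to\psi),(r_\beta,\phi)\in F$ implies $((s\cdot r)_{\alpha\land\beta},\psi)\in F$; (2) $\phi\in\Lambda$ implies $(e_\top,\phi)\in F$; (3) if $Ky_a^r(\phi,\psi)\land\phi\in\Gamma$ then $(f_a^\phi(\psi),\psi)\in F$; (4) each value $f_a^\phi(\psi)$ is of the form $t_\phi$ for some $t\in\hat{E}^c$. Here $\psi_\phi$ denotes the element $t_\phi$ with $t$ the atomic term $\psi$. -}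

module Defs where

open import Data.Nat using (ℕ)
open import Data.Bool using (Bool; true; false; not; _∧_)
open import Data.List using (List; []; _∷_)
open import Data.List.Relation.Unary.All using (All)
open import Data.Product using (Σ; _×_; _,_)
open import Data.Sum using (_⊎_)
open import Data.Unit using (⊤; tt)
open import Data.Empty using (⊥)
open import Relation.Nullary using (¬_)
open import Relation.Binary.PropositionalEquality using (_≡_)
open import Function.Definitions using (Injective)

Countable : Set → Set
Countable A = Σ (A → ℕ) (Injective _≡_ _≡_)

data Formula (A : Set) : Set where
  atom : ℕ → Formula A
  ~_   : Formula A → Formula A
  _∧'_ : Formula A → Formula A → Formula A
  K    : A → Formula A → Formula A
  Ky   : A → Formula A → Formula A → Formula A

infix 9 ~_
infixr 7 _∧'_

module _ {A : Set} where

  infixr 6 _⇒_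
  _⇒_ : Formula A → Formula A → Formula A
  φ ⇒ ψ = ~ (φ ∧' ~ ψ)

  ⊤' : Formula A
  ⊤' = ~ (atom 0 ∧' ~ atom 0)

  ⊥' : Formula A
  ⊥' = ~ ⊤'

  eval : (Formula A → Bool) → Formula A → Bool
  eval v (atom p)   = v (atom p)
  eval v (~ φ)      = not (eval v φ)
  eval v (φ ∧' ψ)   = eval v φ ∧ eval v ψ
  eval v (K a φ)    = v (K a φ)
  eval v (Ky a φ ψ) = v (Ky a φ ψ)

  Tautology : Formula A → Set
  Tautology φ = (v : Formula A → Bool) → eval v φ ≡ true

  data ⊢[_]_ (Λ : Formula A → Set) : Formula A → Set where
    PT   : ∀ {φ} → Tautology φ → ⊢[ Λ ] φ
    AxK  : ∀ {a φ ψ} → ⊢[ Λ ] (K a (φ ⇒ ψ) ⇒ (K a φ ⇒ K a ψ))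
    AxT  : ∀ {a φ} → ⊢[ Λ ] (K a φ ⇒ φ)
    Ax4  : ∀ {a φ} → ⊢[ Λ ] (K a φ ⇒ K a (K a φ))
    Ax5  : ∀ {a φ} → ⊢[ Λ ] (~ K a φ ⇒ K a (~ K a φ))
    EKyR : ∀ {a χ φ ψ θ} →
           ⊢[ Λ ] (Ky a χ (φ ⇒ ψ) ⇒ (Ky a θ φ ⇒ Ky a (χ ∧' θ) ψ))
    4YKR : ∀ {a φ ψ} → ⊢[ Λ ] (Ky a φ ψ ⇒ K a (Ky a φ ψ))
    DKyR : ∀ {a φ ψ} → ⊢[ Λ ] (Ky a φ ψ ⇒ K a (φ ⇒ ψ))
    IKyR : ∀ {a φ ψ χ} → ⊢[ Λ ] (Ky a ψ χ ⇒ (K a (φ ⇒ ψ) ⇒ Ky a φ χ))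
    UKyR : ∀ {a φ ψ} → ⊢[ Λ ] (K a (~ φ) ⇒ Ky a φ ψ)
    MP   : ∀ {φ ψ} → ⊢[ Λ ] (φ ⇒ ψ) → ⊢[ Λ ] φ → ⊢[ Λ ] ψ
    NK   : ∀ {a φ} → ⊢[ Λ ] φ → ⊢[ Λ ] K a φ
    NKyR : ∀ {a φ} → Λ φ → ⊢[ Λ ] Ky a ⊤' φ

  conj : List (Formula A) → Formula A
  conj []       = ⊤'
  conj (φ ∷ l)  = φ ∧' conj l

  Consistent : (Λ Γ : Formula A → Set) → Set
  Consistent Λ Γ = (l : List (Formula A)) → All Γ l → ¬ (⊢[ Λ ] (~ conj l))

  MaxCons : (Λ Γ : Formula A → Set) → Set
  MaxCons Λ Γ = Consistent Λ Γ ×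
    ((φ : Formula A) → ¬ Γ φ → ¬ Consistent Λ (λ ψ → Γ ψ ⊎ ψ ≡ φ))

  data Term : Set where
    e    : Term
    form : Formula A → Term
    _·_  : Term → Term → Term

  NotE : Term → Set
  NotE e = ⊥
  NotE _ = ⊤

  -- E^c = {e_⊤} ∪ {t_φ | t ∈ Ê^c \ {e}, φ ∈ L}
  data Ec : Set where
    eTop : Ec
    sub  : (t : Term) → NotE t → Formula A → Ec

  termOf : Ec → Term
  termOf eTop        = e
  termOf (sub t _ _) = t

  -- the formula index φ of t_φ (e_⊤ read as t = e, φ = ⊤)
  indexOf : Ec → Formula A
  indexOf eTop        = ⊤'
  indexOf (sub _ _ φ) = φ

  _∙_ : Ec → Ec → Ec
  x ∙ y = sub (termOf x · termOf y) tt (indexOf x ∧' indexOf y)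

  _at_ : Formula A → Formula A → Ec
  ψ at φ = sub (form ψ) tt φ

  Fam : (Γ : Formula A → Set) → Set
  Fam Γ = (a : A) (φ ψ : Formula A) → Γ (Ky a φ ψ) → Ec

  InWc : (Λ Γ : Formula A → Set) → (Ec → Formula A → Set) → Fam Γ → Set
  InWc Λ Γ F f =
    MaxCons Λ Γ ×
    ((x y : Ec) (φ ψ : Formula A) → F x (φ ⇒ ψ) → F y φ → F (x ∙ y) ψ) ×
    ((φ : Formula A) → Λ φ → F eTop φ) ×
    ((a : A) (φ ψ : Formula A) → Γ (Ky a φ ψ ∧' φ) →
       (m : Γ (Ky a φ ψ)) → F (f a φ ψ m) ψ) ×
    ((a : A) (φ ψ : Formula A) (m : Γ (Ky a φ ψ)) →
       -- f a φ ψ m is of the form t_φ, i.e. its index is φ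
       indexOf (f a φ ψ m) ≡ φ)

  data F0 (Λ Γ : Formula A → Set) : Ec → Formula A → Set where
    fromΛ  : ∀ {φ} → Λ φ → F0 Λ Γ eTop φ
    fromKy : ∀ {φ ψ} (b : A) → Γ (Ky b φ ψ ∧' φ) → F0 Λ Γ (ψ at φ) ψ

  Fn : (Λ Γ : Formula A → Set) → ℕ → Ec → Formula A → Set
  Fn Λ Γ ℕ.zero    x χ = F0 Λ Γ x χ
  Fn Λ Γ (ℕ.suc n) x χ = Fn Λ Γ n x χ ⊎
    Σ Ec (λ s → Σ Ec (λ r → Σ (Formula A) (λ φ →
      (x ≡ s ∙ r) × Fn Λ Γ n s (φ ⇒ χ) × Fn Λ Γ n r φ)))

  FΓ : (Λ Γ : Formula A → Set) → Ec → Formula A → Set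
  FΓ Λ Γ x χ = Σ ℕ (λ n → Fn Λ Γ n x χ)

  fΓ : (Γ : Formula A → Set) → Fam Γ
  fΓ Γ b φ ψ _ = ψ at φ

-- The only real
-- content is that this union is closed under the product rule
-- (condition (1) of W^c): since the stages are increasing, two
-- witnesses living at stages m and n both live at stage m ⊔ n, and one
-- more round puts their product at stage suc (m ⊔ n).
module Submission where

open import Defs
open import Data.Nat using (ℕ; zero; suc; _≤_; _≤′_; _⊔_; ≤′-refl; ≤′-step)
open import Data.Nat.Properties using (≤⇒≤′; m≤m⊔n; m≤n⊔m)
open import Data.Product using (_,_)
open import Data.Sum using (inj₁; inj₂)
open import Relation.Binary.PropositionalEquality using (refl)

module _ {A : Set} (Λ Γ : Formula A → Set) where

  -- The stages form an increasing chain: F^Γ_m ⊆ F^Γ_n for m ≤ n.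
  -- Proved along the inductive order _≤′_, where each step is the
  -- left injection F^Γ_n ⊆ F^Γ_{n+1} built into the definition.
  Fn-mono′ : ∀ {m n} → m ≤′ n → ∀ {x χ} → Fn Λ Γ m x χ → Fn Λ Γ n x χ
  Fn-mono′ ≤′-refl        p = p
  Fn-mono′ (≤′-step m≤′n) p = inj₁ (Fn-mono′ m≤′n p)

  Fn-mono : ∀ {m n} → m ≤ n → ∀ {x χ} → Fn Λ Γ m x χ → Fn Λ Γ n x χ
  Fn-mono m≤n = Fn-mono′ (≤⇒≤′ m≤n)

  FΓ-app : (x y : Ec) (φ ψ : Formula A) →
           FΓ Λ Γ x (φ ⇒ ψ) → FΓ Λ Γ y φ → FΓ Λ Γ (x ∙ y) ψ
  FΓ-app x y φ ψ (m , x⊢φ⇒ψ) (n , y⊢φ) =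
    suc (m ⊔ n) ,
    inj₂ (x , y , φ , refl , Fn-mono (m≤m⊔n m n) x⊢φ⇒ψ , Fn-mono (m≤n⊔m m n) y⊢φ)

  FΓ-ground : (φ : Formula A) → Λ φ → FΓ Λ Γ eTop φ
  FΓ-ground φ φ∈Λ = zero , fromΛ φ∈Λ

  FΓ-witness : (a : A) (φ ψ : Formula A) → Γ (Ky a φ ψ ∧' φ) →
               (m : Γ (Ky a φ ψ)) → FΓ Λ Γ (fΓ Γ a φ ψ m) ψ
  FΓ-witness a φ ψ Ky∧φ∈Γ _ = zero , fromKy a Ky∧φ∈Γ

proposition3p18 : (A : Set) → Countable A → (Λ Γ : Formula A → Set) →
    MaxCons Λ Γ → InWc Λ Γ (FΓ Λ Γ) (fΓ Γ)
proposition3p18 A _ Λ Γ Γ-maxcons =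
  Γ-maxcons ,
  FΓ-app Λ Γ ,
  FΓ-ground Λ Γ ,
  FΓ-witness Λ Γ ,
  (λ a φ ψ m → refl)
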